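{- Let $r\ge1$ and let $(t_{i,j})_{i\in[0,r+1],j\in\mathbb{Z}}$ satisfy $t_{0,j}=t_{r+1,j}=1$ for all $j$, $t_{i,0}=1$ for $i\in[1,r]$, $t_{i,j}$ ($i\in[1,r]$, $j\ge1$) nonzero (e.g. formal variables), and $t_{r+1-i,-r-1-j}=(-1)^{ri}t_{i,j}$ for $i\in[1,r]$, $j\ge0$. Then for every $i\in[1,r]$ and $j\ge1$: $$V_{r+1-i}\big(t_{r-i,-r-j},t_{r+1-i,-r-1-j},t_{r+1-i,-r-j}\big)\,P\,U_i\big(t_{i,j-1},t_{i,j},t_{i+1,j-1}\big)=P,$$ $$U_{r+1-i}\big(t_{r+1-i,-r-1-j},t_{r+1-i,-r-j},t_{r+2-i,-r-1-j}\big)\,P\,V_i\big(t_{i-1,j},t_{i,j-1},t_{i,j}\big)=P.$$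
   Context: For $i\in[1,r]$ and nonzero $a,b,c$, $U_i(a,b,c)$ (resp. $V_i(a,b,c)$) is the $(r+1)\times(r+1)$ identity matrix except that its $2\times 2$ block in rows/columns $i,i+1$ is $\begin{pmatrix}1&0\\ c/b& a/b\end{pmatrix}$ (resp. $\begin{pmatrix}b/c& a/c\\ 0&1\end{pmatrix}$). $P$ is the $(r+1)\times(r+1)$ matrix with entries $P_{i,j}=(-1)^{(r-1)(i-1)}\delta_{i+j,r+2}$. -}

module Defs where

open import Level using (Level; _⊔_) renaming (suc to lsuc)
open import Algebra.Bundles using (CommutativeRing)
open import Data.Nat as ℕ using (ℕ; zero; suc; _≟_)
open import Data.Fin using (Fin; toℕ)
import Data.Fin as Fin
open import Relation.Nullary using (¬_; yes; no)
open import Relation.Nullary.Decidable using (_×-dec_)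

-- A field: a commutative ring with 1 ≠ 0 in which every nonzero element
-- has a multiplicative inverse (given as a total function x ↦ x ⁻¹,
-- whose value at 0 is irrelevant).
record Field (c ℓ : Level) : Set (lsuc (c ⊔ ℓ)) where
  field
    commutativeRing : CommutativeRing c ℓ
  open CommutativeRing commutativeRing public
  field
    _⁻¹      : Carrier → Carrier
    ⁻¹-cong  : ∀ {x y} → x ≈ y → x ⁻¹ ≈ y ⁻¹
    1≉0      : ¬ (1# ≈ 0#)
    inverseʳ : ∀ x → ¬ (x ≈ 0#) → x * (x ⁻¹) ≈ 1#

  _/_ : Carrier → Carrier → Carrier
  x / y = x * (y ⁻¹)

module Matrices {c ℓ} (F : Field c ℓ) where
  open Field F public

  Mat : ℕ → Set c
  Mat n = Fin n → Fin n → Carrier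

  _≈M_ : ∀ {n} → Mat n → Mat n → Set ℓ
  A ≈M B = ∀ p q → A p q ≈ B p q

  ∑ : ∀ n → (Fin n → Carrier) → Carrier
  ∑ zero    f = 0#
  ∑ (suc n) f = f Fin.zero + ∑ n (λ k → f (Fin.suc k))

  _·_ : ∀ {n} → Mat n → Mat n → Mat n
  (A · B) p q = ∑ _ (λ k → A p k * B k q)

  sgn : ℕ → Carrier
  sgn zero    = 1#
  sgn (suc k) = - sgn k

  δ : ℕ → ℕ → Carrier
  δ m n with m ≟ n
  ... | yes _ = 1#
  ... | no  _ = 0#

  -- In what follows a matrix of size r+1 has rows/columns numbered 1..r+1
  -- as in the paper: row ρ = 1 + toℕ p.

  -- U_i(a,b,c): identity except block rows/cols i,i+1 = [[1,0],[c/b,a/b]]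
  U : (r i : ℕ) → Carrier → Carrier → Carrier → Mat (suc r)
  U r i a b c' p q with (suc (toℕ p) ≟ suc i) ×-dec (suc (toℕ q) ≟ i)
  ... | yes _ = c' / b
  ... | no _ with (suc (toℕ p) ≟ suc i) ×-dec (suc (toℕ q) ≟ suc i)
  ...   | yes _ = a / b
  ...   | no _  = δ (toℕ p) (toℕ q)

  -- V_i(a,b,c): identity except block rows/cols i,i+1 = [[b/c,a/c],[0,1]]
  V : (r i : ℕ) → Carrier → Carrier → Carrier → Mat (suc r)
  V r i a b c' p q with (suc (toℕ p) ≟ i) ×-dec (suc (toℕ q) ≟ i)
  ... | yes _ = b / c'
  ... | no _ with (suc (toℕ p) ≟ i) ×-dec (suc (toℕ q) ≟ suc i)
  ...   | yes _ = a / c'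
  ...   | no _  = δ (toℕ p) (toℕ q)

  -- P_{ρ,σ} = (-1)^{(r-1)(ρ-1)} δ_{ρ+σ, r+2}
  P : (r : ℕ) → Mat (suc r)
  P r p q with suc (toℕ p) ℕ.+ suc (toℕ q) ≟ suc (suc r)
  ... | yes _ = sgn ((r ℕ.∸ 1) ℕ.* toℕ p)
  ... | no _  = 0#

module Submission where

open import Defs
open import Data.Nat using (ℕ; zero; suc; _∸_; _≤_; _<_; z≤n; s≤s; _≟_)
import Data.Nat as ℕ
import Data.Nat.Properties as ℕP
open import Data.Integer using (ℤ; +_) renaming (-_ to -ℤ_)
open import Data.Product using (_×_; _,_; proj₁; proj₂)
open import Data.Sum using (inj₁; inj₂)
open import Data.Fin as Fin using (Fin; toℕ)
open import Data.Fin.Properties using (toℕ<n)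
open import Data.Empty using (⊥-elim)
open import Relation.Nullary using (¬_; yes; no)
open import Relation.Nullary.Decidable using (_×-dec_)
open import Relation.Binary.PropositionalEquality as ≡ using (_≡_; _≢_)

-- P is the signed antidiagonal matrix, so multiplying by P
-- reverses the order of rows/columns.  Call a matrix a block matrix at k if
-- it differs from the identity only in the 2×2 block at rows/columns k, k+1.
-- If E is a block matrix at K and G one at i-1 with K + i = r, then the
-- identity E·P·G = P reduces to a 2×2 identity between the blocks (the
-- sandwich lemma).  U_i and V_i are block matrices at i-1, and so are the
-- left factors V_{r+1-i}, U_{r+1-i} at K = r-i; the resulting four scalar
-- identities per equation follow from the symmetry
-- t_{r+1-i,-r-1-j} = (-1)^{ri} t_{i,j}, which extends to the boundary rows
-- i = 0 and i = r+1, together with sign and quotient calculus in the field.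

data Slot (k : ℕ) : ℕ → Set where
  first   : Slot k k
  second  : Slot k (suc k)
  outside : ∀ {p} → p ≢ k → p ≢ suc k → Slot k p

slot : ∀ k p → Slot k p
slot k p with p ≟ k | p ≟ suc k
... | yes ≡.refl | _          = first
... | no _       | yes ≡.refl = second
... | no p≢k     | no p≢1+k   = outside p≢k p≢1+k

complement-uniqueˡ : ∀ {m n q r} → m ℕ.+ q ≡ r → n ℕ.+ q ≡ r → m ≡ n
complement-uniqueˡ {m} {n} {q} m+q≡r n+q≡r = ℕP.+-cancelʳ-≡ q m n (≡.trans m+q≡r (≡.sym n+q≡r))

complement-uniqueʳ : ∀ {m p q r} → m ℕ.+ p ≡ r → m ℕ.+ q ≡ r → p ≡ q
complement-uniqueʳ {m} {p} {q} m+p≡r m+q≡r = ℕP.+-cancelˡ-≡ m p q (≡.trans m+p≡r (≡.sym m+q≡r))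

module Development {c ℓ} (F : Field c ℓ) where
  open Matrices F
  open import Relation.Binary.Reasoning.Setoid setoid
  open import Algebra.Solver.CommutativeMonoid *-commutativeMonoid using (solve; _⊜_; _⊕_)
  open import Algebra.Properties.Ring ring using (-‿distribˡ-*; -‿distribʳ-*; -‿involutive)

  sgn-+ : ∀ m n → sgn (m ℕ.+ n) ≈ sgn m * sgn n
  sgn-+ zero    n = sym (*-identityˡ _)
  sgn-+ (suc m) n = trans (-‿cong (sgn-+ m n)) (-‿distribˡ-* (sgn m) (sgn n))

  sgn-square : ∀ m → sgn m * sgn m ≈ 1#
  sgn-square zero    = *-identityˡ 1#
  sgn-square (suc m) = begin
    - sgn m * - sgn m     ≈⟨ -‿distribˡ-* (sgn m) (- sgn m) ⟨
    - (sgn m * - sgn m)   ≈⟨ -‿cong (-‿distribʳ-* (sgn m) (sgn m)) ⟨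
    - - (sgn m * sgn m)   ≈⟨ -‿involutive _ ⟩
    sgn m * sgn m         ≈⟨ sgn-square m ⟩
    1#                    ∎

  sgn-*suc : ∀ m n → sgn (m ℕ.* suc n) ≈ sgn m * sgn (m ℕ.* n)
  sgn-*suc m n = trans (reflexive (≡.cong sgn (ℕP.*-suc m n))) (sgn-+ m (m ℕ.* n))

  -- (-1)^{n²} = (-1)^n, since n² ≡ n (mod 2)
  sgn-of-square : ∀ n → sgn (n ℕ.* n) ≈ sgn n
  sgn-of-square zero    = refl
  sgn-of-square (suc n) = -‿cong (begin
    sgn (n ℕ.+ n ℕ.* suc n)           ≈⟨ reflexive (≡.cong (λ k → sgn (n ℕ.+ k)) (ℕP.*-suc n n)) ⟩
    sgn (n ℕ.+ (n ℕ.+ n ℕ.* n))       ≈⟨ reflexive (≡.cong sgn (≡.sym (ℕP.+-assoc n n (n ℕ.* n)))) ⟩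
    sgn ((n ℕ.+ n) ℕ.+ n ℕ.* n)       ≈⟨ sgn-+ (n ℕ.+ n) (n ℕ.* n) ⟩
    sgn (n ℕ.+ n) * sgn (n ℕ.* n)     ≈⟨ *-cong (trans (sgn-+ n n) (sgn-square n)) (sgn-of-square n) ⟩
    1# * sgn n                        ≈⟨ *-identityˡ _ ⟩
    sgn n                             ∎)

  inverse-unique : ∀ x y → x * y ≈ 1# → x ⁻¹ ≈ y
  inverse-unique x y xy≈1 = begin
    x ⁻¹               ≈⟨ *-identityˡ _ ⟨
    1# * x ⁻¹          ≈⟨ *-congʳ xy≈1 ⟨
    (x * y) * x ⁻¹     ≈⟨ solve 3 (λ x y x⁻¹ → (x ⊕ y) ⊕ x⁻¹ ⊜ y ⊕ (x ⊕ x⁻¹)) refl x y (x ⁻¹) ⟩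
    y * (x * x ⁻¹)     ≈⟨ *-congˡ (inverseʳ x x≉0) ⟩
    y * 1#             ≈⟨ *-identityʳ y ⟩
    y                  ∎
    where
    x≉0 : ¬ (x ≈ 0#)
    x≉0 x≈0 = 1≉0 (trans (sym xy≈1) (trans (*-congʳ x≈0) (zeroˡ y)))

  unit-cancelˡ : ∀ {u x} → u * u ≈ 1# → u * (u * x) ≈ x
  unit-cancelˡ {u} {x} uu≈1 = trans (sym (*-assoc u u x)) (trans (*-congʳ uu≈1) (*-identityˡ x))

  unit-inverse : ∀ {u y} → u * u ≈ 1# → ¬ (y ≈ 0#) → (u * y) ⁻¹ ≈ u * y ⁻¹
  unit-inverse {u} {y} uu≈1 y≉0 = inverse-unique (u * y) (u * y ⁻¹) (begin
    (u * y) * (u * y ⁻¹)   ≈⟨ solve 3 (λ u y y⁻¹ → (u ⊕ y) ⊕ (u ⊕ y⁻¹) ⊜ (u ⊕ u) ⊕ (y ⊕ y⁻¹))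
                                      refl u y (y ⁻¹) ⟩
    (u * u) * (y * y ⁻¹)   ≈⟨ *-cong uu≈1 (inverseʳ y y≉0) ⟩
    1# * 1#                ≈⟨ *-identityˡ 1# ⟩
    1#                     ∎)

  signed-quotient : ∀ {u v x y X Y} → u * u ≈ 1# → ¬ (y ≈ 0#) →
    X ≈ (v * u) * x → Y ≈ u * y → X / Y ≈ v * (x / y)
  signed-quotient {u} {v} {x} {y} {X} {Y} uu≈1 y≉0 X≈ Y≈ = begin
    X * Y ⁻¹                   ≈⟨ *-cong X≈ (trans (⁻¹-cong Y≈) (unit-inverse uu≈1 y≉0)) ⟩
    ((v * u) * x) * (u * y ⁻¹) ≈⟨ solve 4 (λ v u x y⁻¹ → ((v ⊕ u) ⊕ x) ⊕ (u ⊕ y⁻¹) ⊜ v ⊕ (u ⊕ (u ⊕ (x ⊕ y⁻¹))))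
                                          refl v u x (y ⁻¹) ⟩
    v * (u * (u * (x * y ⁻¹))) ≈⟨ *-congˡ (unit-cancelˡ uu≈1) ⟩
    v * (x * y ⁻¹)             ∎

  same-sign-quotient : ∀ {u x y X Y} → u * u ≈ 1# → ¬ (y ≈ 0#) →
    X ≈ u * x → Y ≈ u * y → X / Y ≈ x / y
  same-sign-quotient {u} {x} {y} uu≈1 y≉0 X≈ Y≈ =
    trans (signed-quotient uu≈1 y≉0 (trans X≈ (*-congʳ (sym (*-identityˡ u)))) Y≈) (*-identityˡ (x / y))

  zero-coefficient : ∀ s u → (0# * s) * u ≈ 0#
  zero-coefficient s u = trans (*-congʳ (zeroˡ s)) (zeroˡ u)

  unit-coefficient : ∀ s → (1# * s) * 1# ≈ s
  unit-coefficient s = trans (*-identityʳ _) (*-identityˡ s)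

  quotient-cancel : ∀ {x y} u → ¬ (x ≈ 0#) → ¬ (y ≈ 0#) → ((x / y) * u) * (y / x) ≈ u
  quotient-cancel {x} {y} u x≉0 y≉0 = begin
    ((x * y ⁻¹) * u) * (y * x ⁻¹)      ≈⟨ solve 5 (λ x y x⁻¹ y⁻¹ u →
                                              ((x ⊕ y⁻¹) ⊕ u) ⊕ (y ⊕ x⁻¹) ⊜ ((x ⊕ x⁻¹) ⊕ (y ⊕ y⁻¹)) ⊕ u)
                                            refl x y (x ⁻¹) (y ⁻¹) u ⟩
    ((x * x ⁻¹) * (y * y ⁻¹)) * u      ≈⟨ *-congʳ (*-cong (inverseʳ x x≉0) (inverseʳ y y≉0)) ⟩
    (1# * 1#) * u                      ≈⟨ trans (*-congʳ (*-identityˡ 1#)) (*-identityˡ u) ⟩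
    u                                  ∎

  quotient-chain : ∀ {x y z} u → ¬ (y ≈ 0#) → ((y / x) * u) * (z / y) ≈ (z / x) * u
  quotient-chain {x} {y} {z} u y≉0 = begin
    ((y * x ⁻¹) * u) * (z * y ⁻¹)   ≈⟨ solve 5 (λ x⁻¹ y y⁻¹ z u →
                                           ((y ⊕ x⁻¹) ⊕ u) ⊕ (z ⊕ y⁻¹) ⊜ (y ⊕ y⁻¹) ⊕ ((z ⊕ x⁻¹) ⊕ u))
                                         refl (x ⁻¹) y (y ⁻¹) z u ⟩
    (y * y ⁻¹) * ((z * x ⁻¹) * u)   ≈⟨ *-congʳ (inverseʳ y y≉0) ⟩
    1# * ((z * x ⁻¹) * u)           ≈⟨ *-identityˡ _ ⟩
    (z * x ⁻¹) * u                  ∎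

  ∑ℕ : ℕ → (ℕ → Carrier) → Carrier
  ∑ℕ zero    g = 0#
  ∑ℕ (suc n) g = g 0 + ∑ℕ n (λ k → g (suc k))

  ∑-as-∑ℕ : ∀ n (g : ℕ → Carrier) → ∑ n (λ k → g (toℕ k)) ≈ ∑ℕ n g
  ∑-as-∑ℕ zero    g = refl
  ∑-as-∑ℕ (suc n) g = +-congˡ (∑-as-∑ℕ n (λ k → g (suc k)))

  ∑ℕ-zero : ∀ n {g : ℕ → Carrier} → (∀ k → g k ≈ 0#) → ∑ℕ n g ≈ 0#
  ∑ℕ-zero zero    g≈0 = refl
  ∑ℕ-zero (suc n) g≈0 = trans (+-cong (g≈0 0) (∑ℕ-zero n (λ k → g≈0 (suc k)))) (+-identityʳ 0#)

  ∑ℕ-single : ∀ n m {g : ℕ → Carrier} → m < n → (∀ k → k ≢ m → g k ≈ 0#) → ∑ℕ n g ≈ g m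
  ∑ℕ-single (suc n) zero    {g} _ g≈0 =
    trans (+-congˡ (∑ℕ-zero n (λ k → g≈0 (suc k) λ ()))) (+-identityʳ (g 0))
  ∑ℕ-single (suc n) (suc m) {g} (s≤s m<n) g≈0 =
    trans (+-cong (g≈0 0 λ ()) (∑ℕ-single n m m<n (λ k k≢m → g≈0 (suc k) (λ e → k≢m (ℕP.suc-injective e)))))
          (+-identityˡ (g (suc m)))

  ∑ℕ-pair : ∀ n m {g : ℕ → Carrier} → suc m < n → (∀ k → k ≢ m → k ≢ suc m → g k ≈ 0#) →
    ∑ℕ n g ≈ g m + g (suc m)
  ∑ℕ-pair (suc n) zero    {g} (s≤s 1<n) g≈0 =
    +-congˡ (∑ℕ-single n 0 1<n (λ k k≢0 → g≈0 (suc k) (λ ()) (λ e → k≢0 (ℕP.suc-injective e))))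
  ∑ℕ-pair (suc n) (suc m) {g} (s≤s m<n) g≈0 =
    trans (+-cong (g≈0 0 (λ ()) (λ ())) (∑ℕ-pair n m m<n (λ k k≢m k≢1+m →
                     g≈0 (suc k) (λ e → k≢m (ℕP.suc-injective e)) (λ e → k≢1+m (ℕP.suc-injective e)))))
          (+-identityˡ _)

  MatN : Set c
  MatN = ℕ → ℕ → Carrier

  mul : ℕ → MatN → MatN → MatN
  mul n A B p q = ∑ℕ n (λ k → A p k * B k q)

  _represents_ : ∀ {n} → MatN → Mat n → Set ℓ
  A′ represents A = ∀ p q → A p q ≈ A′ (toℕ p) (toℕ q)

  mul-represents : ∀ n (A′ B′ : MatN) {A B : Mat n} →
    A′ represents A → B′ represents B → mul n A′ B′ represents (A · B)
  mul-represents n A′ B′ A≈ B≈ p q =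
    trans (∑-cong n (λ k → *-cong (A≈ p k) (B≈ k q))) (∑-as-∑ℕ n (λ k → A′ (toℕ p) k * B′ k (toℕ q)))
    where
    ∑-cong : ∀ n {f g : Fin n → Carrier} → (∀ k → f k ≈ g k) → ∑ n f ≈ ∑ n g
    ∑-cong zero    f≈g = refl
    ∑-cong (suc n) f≈g = +-cong (f≈g Fin.zero) (∑-cong n (λ k → f≈g (Fin.suc k)))

  δ-refl : ∀ m → δ m m ≈ 1#
  δ-refl m with m ≟ m
  ... | yes _   = refl
  ... | no m≢m  = ⊥-elim (m≢m ≡.refl)

  δ-≢ : ∀ {m n} → m ≢ n → δ m n ≈ 0#
  δ-≢ {m} {n} m≢n with m ≟ n
  ... | yes m≡n = ⊥-elim (m≢n m≡n)
  ... | no _    = refl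

  ε : ℕ → ℕ → Carrier
  ε r m = sgn ((r ∸ 1) ℕ.* m)

  Uℕ : (r i : ℕ) → Carrier → Carrier → Carrier → MatN
  Uℕ r i a b c′ p q with (suc p ≟ suc i) ×-dec (suc q ≟ i)
  ... | yes _ = c′ / b
  ... | no _ with (suc p ≟ suc i) ×-dec (suc q ≟ suc i)
  ...   | yes _ = a / b
  ...   | no _  = δ p q

  Vℕ : (r i : ℕ) → Carrier → Carrier → Carrier → MatN
  Vℕ r i a b c′ p q with (suc p ≟ i) ×-dec (suc q ≟ i)
  ... | yes _ = b / c′
  ... | no _ with (suc p ≟ i) ×-dec (suc q ≟ suc i)
  ...   | yes _ = a / c′
  ...   | no _  = δ p q

  Pℕ : (r : ℕ) → MatN
  Pℕ r p q with suc p ℕ.+ suc q ≟ suc (suc r)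
  ... | yes _ = ε r p
  ... | no _  = 0#

  U-represented : ∀ r i a b c′ → Uℕ r i a b c′ represents U r i a b c′
  U-represented r i a b c′ p q with (suc (toℕ p) ≟ suc i) ×-dec (suc (toℕ q) ≟ i)
  ... | yes _ = refl
  ... | no _ with (suc (toℕ p) ≟ suc i) ×-dec (suc (toℕ q) ≟ suc i)
  ...   | yes _ = refl
  ...   | no _  = refl

  V-represented : ∀ r i a b c′ → Vℕ r i a b c′ represents V r i a b c′
  V-represented r i a b c′ p q with (suc (toℕ p) ≟ i) ×-dec (suc (toℕ q) ≟ i)
  ... | yes _ = refl
  ... | no _ with (suc (toℕ p) ≟ i) ×-dec (suc (toℕ q) ≟ suc i)
  ...   | yes _ = refl
  ...   | no _  = refl

  P-represented : ∀ r → Pℕ r represents P r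
  P-represented r p q with suc (toℕ p) ℕ.+ suc (toℕ q) ≟ suc (suc r)
  ... | yes _ = refl
  ... | no _  = refl

  P-on : ∀ r m q → m ℕ.+ q ≡ r → Pℕ r m q ≈ ε r m
  P-on r m q m+q≡r with suc m ℕ.+ suc q ≟ suc (suc r)
  ... | yes _ = refl
  ... | no ≢  = ⊥-elim (≢ (≡.cong suc (≡.trans (ℕP.+-suc m q) (≡.cong suc m+q≡r))))

  P-off : ∀ r p q → p ℕ.+ q ≢ r → Pℕ r p q ≈ 0#
  P-off r p q p+q≢r with suc p ℕ.+ suc q ≟ suc (suc r)
  ... | yes ≡ = ⊥-elim (p+q≢r (ℕP.suc-injective (≡.trans (≡.sym (ℕP.+-suc p q)) (ℕP.suc-injective ≡))))
  ... | no _  = refl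

  P-as-δ : ∀ r p {m q} → m ℕ.+ q ≡ r → Pℕ r p q ≈ δ p m * ε r m
  P-as-δ r p {m} {q} m+q≡r with p ≟ m
  ... | yes ≡.refl = trans (P-on r p q m+q≡r) (sym (*-identityˡ _))
  ... | no p≢m     = trans (P-off r p q (λ p+q≡r → p≢m (complement-uniqueˡ p+q≡r m+q≡r))) (sym (zeroˡ _))

  mul-P : ∀ r A p {m k} → m ℕ.+ k ≡ r → mul (suc r) A (Pℕ r) p k ≈ A p m * ε r m
  mul-P r A p {m} {k} m+k≡r = trans
    (∑ℕ-single (suc r) m {λ n → A p n * Pℕ r n k} (s≤s (≡.subst (m ≤_) m+k≡r (ℕP.m≤m+n m k)))
      (λ n n≢m → trans (*-congˡ (P-off r n k (λ n+k≡r → n≢m (complement-uniqueˡ n+k≡r m+k≡r)))) (zeroʳ _)))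
    (*-congˡ (P-on r m k m+k≡r))

  record IsBlock (k : ℕ) (M : MatN) (x y z w : Carrier) : Set ℓ where
    field
      entry₀₀      : M k k ≈ x
      entry₀₁      : M k (suc k) ≈ y
      entry₁₀      : M (suc k) k ≈ z
      entry₁₁      : M (suc k) (suc k) ≈ w
      rows-outside : ∀ p q → p ≢ k → p ≢ suc k → M p q ≈ δ p q
      cols-outside : ∀ p q → q ≢ k → q ≢ suc k → M p q ≈ δ p q

  mul-unit-column : ∀ n X G p {q} → q < n → (∀ k → G k q ≈ δ k q) → mul n X G p q ≈ X p q
  mul-unit-column n X G p {q} q<n Gq≈δ = begin
    ∑ℕ n (λ k → X p k * G k q) ≈⟨ ∑ℕ-single n q {λ k → X p k * G k q} q<n
                                    (λ k k≢q → trans (*-congˡ (trans (Gq≈δ k) (δ-≢ k≢q))) (zeroʳ _)) ⟩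
    X p q * G q q              ≈⟨ *-congˡ (trans (Gq≈δ q) (δ-refl q)) ⟩
    X p q * 1#                 ≈⟨ *-identityʳ _ ⟩
    X p q                      ∎

  mul-block-column : ∀ n X G {i x y z w} → IsBlock i G x y z w → suc i < n →
    ∀ p {q} → (∀ k → k ≢ i → k ≢ suc i → k ≢ q) →
    mul n X G p q ≈ X p i * G i q + X p (suc i) * G (suc i) q
  mul-block-column n X G G-block 1+i<n p {q} q-in-block = ∑ℕ-pair n _ {λ k → X p k * G k q} 1+i<n
    (λ k k≢i k≢1+i → trans (*-congˡ (trans (rows-outside k q k≢i k≢1+i) (δ-≢ (q-in-block k k≢i k≢1+i))))
                           (zeroʳ _))
    where open IsBlock G-block

  module _ (r k : ℕ) (a b c′ : Carrier) where

    private
      U′ : MatN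
      U′ = Uℕ r (suc k) a b c′

      k≢1+k : k ≢ suc k
      k≢1+k = ℕP.<⇒≢ (ℕP.n<1+n k)

    U-identity-entry : ∀ {p q} → (p ≡ suc k → q ≢ k × q ≢ suc k) → U′ p q ≈ δ p q
    U-identity-entry {p} {q} off with (suc p ≟ suc (suc k)) ×-dec (suc q ≟ suc k)
    ... | yes (p≡ , q≡) = ⊥-elim (proj₁ (off (ℕP.suc-injective p≡)) (ℕP.suc-injective q≡))
    ... | no _ with (suc p ≟ suc (suc k)) ×-dec (suc q ≟ suc (suc k))
    ...   | yes (p≡ , q≡) = ⊥-elim (proj₂ (off (ℕP.suc-injective p≡)) (ℕP.suc-injective q≡))
    ...   | no _          = refl

    U-is-block : IsBlock k U′ 1# 0# (c′ / b) (a / b)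
    U-is-block = record
      { entry₀₀      = trans (U-identity-entry (λ k≡1+k → ⊥-elim (k≢1+k k≡1+k))) (δ-refl k)
      ; entry₀₁      = trans (U-identity-entry (λ k≡1+k → ⊥-elim (k≢1+k k≡1+k))) (δ-≢ k≢1+k)
      ; entry₁₀      = entry₁₀
      ; entry₁₁      = entry₁₁
      ; rows-outside = λ p q _ p≢1+k → U-identity-entry {p} {q} (λ p≡1+k → ⊥-elim (p≢1+k p≡1+k))
      ; cols-outside = λ p q q≢k q≢1+k → U-identity-entry {p} {q} (λ _ → q≢k , q≢1+k)
      }
      where
      entry₁₀ : U′ (suc k) k ≈ c′ / b
      entry₁₀ with (suc (suc k) ≟ suc (suc k)) ×-dec (suc k ≟ suc k)
      ... | yes _ = refl
      ... | no ≢  = ⊥-elim (≢ (≡.refl , ≡.refl))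

      entry₁₁ : U′ (suc k) (suc k) ≈ a / b
      entry₁₁ with (suc (suc k) ≟ suc (suc k)) ×-dec (suc (suc k) ≟ suc k)
      ... | yes (_ , 2+k≡1+k) = ⊥-elim (ℕP.1+n≢n 2+k≡1+k)
      ... | no _ with (suc (suc k) ≟ suc (suc k)) ×-dec (suc (suc k) ≟ suc (suc k))
      ...   | yes _ = refl
      ...   | no ≢  = ⊥-elim (≢ (≡.refl , ≡.refl))

  module _ (r k : ℕ) (a b c′ : Carrier) where

    private
      V′ : MatN
      V′ = Vℕ r (suc k) a b c′

    V-identity-entry : ∀ {p q} → (p ≡ k → q ≢ k × q ≢ suc k) → V′ p q ≈ δ p q
    V-identity-entry {p} {q} off with (suc p ≟ suc k) ×-dec (suc q ≟ suc k)
    ... | yes (p≡ , q≡) = ⊥-elim (proj₁ (off (ℕP.suc-injective p≡)) (ℕP.suc-injective q≡))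
    ... | no _ with (suc p ≟ suc k) ×-dec (suc q ≟ suc (suc k))
    ...   | yes (p≡ , q≡) = ⊥-elim (proj₂ (off (ℕP.suc-injective p≡)) (ℕP.suc-injective q≡))
    ...   | no _          = refl

    V-is-block : IsBlock k V′ (b / c′) (a / c′) 0# 1#
    V-is-block = record
      { entry₀₀      = entry₀₀
      ; entry₀₁      = entry₀₁
      ; entry₁₀      = trans (V-identity-entry (λ 1+k≡k → ⊥-elim (ℕP.1+n≢n 1+k≡k))) (δ-≢ (ℕP.1+n≢n {k}))
      ; entry₁₁      = trans (V-identity-entry (λ 1+k≡k → ⊥-elim (ℕP.1+n≢n 1+k≡k))) (δ-refl (suc k))
      ; rows-outside = λ p q p≢k _ → V-identity-entry {p} {q} (λ p≡k → ⊥-elim (p≢k p≡k))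
      ; cols-outside = λ p q q≢k q≢1+k → V-identity-entry {p} {q} (λ _ → q≢k , q≢1+k)
      }
      where
      entry₀₀ : V′ k k ≈ b / c′
      entry₀₀ with (suc k ≟ suc k) ×-dec (suc k ≟ suc k)
      ... | yes _ = refl
      ... | no ≢  = ⊥-elim (≢ (≡.refl , ≡.refl))

      entry₀₁ : V′ k (suc k) ≈ a / c′
      entry₀₁ with (suc k ≟ suc k) ×-dec (suc (suc k) ≟ suc k)
      ... | yes (_ , 2+k≡1+k) = ⊥-elim (ℕP.1+n≢n 2+k≡1+k)
      ... | no _ with (suc k ≟ suc k) ×-dec (suc (suc k) ≟ suc (suc k))
      ...   | yes _ = refl
      ...   | no ≢  = ⊥-elim (≢ (≡.refl , ≡.refl))

  -- Let E be a block matrix at K and G one at i with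
  -- K + 1 + i = r, so that P maps the block rows of G onto the block columns
  -- of E.  With σ = ε_K and σ′ = ε_{K+1} the entries of P meeting the blocks,
  -- E·P·G = P holds as soon as the 2×2 identity
  --   [[x, y], [z, w]] · [[0, σ], [σ′, 0]] · [[x′, y′], [z′, w′]] = [[0, σ], [σ′, 0]]
  -- does.  Columns of E·P·G outside G's block are columns of P (E·P·G agrees
  -- with E·P there, and E·P with P); the two block columns reduce to the 2×2
  -- identity above.
  module _ {r K i : ℕ} {E G : MatN} {x y z w x′ y′ z′ w′ : Carrier} (K+1+i≡r : K ℕ.+ suc i ≡ r)
           (E-block : IsBlock K E x y z w) (G-block : IsBlock i G x′ y′ z′ w′) where

    private
      module E = IsBlock E-block
      module G = IsBlock G-block

      EP : MatN
      EP = mul (suc r) E (Pℕ r)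

      σ σ′ : Carrier
      σ  = ε r K
      σ′ = ε r (suc K)

      1+K+i≡r : suc K ℕ.+ i ≡ r
      1+K+i≡r = ≡.trans (≡.sym (ℕP.+-suc K i)) K+1+i≡r

      1+i<1+r : suc i < suc r
      1+i<1+r = s≤s (≡.subst (suc i ≤_) K+1+i≡r (ℕP.m≤n+m (suc i) K))

      entries : ∀ {E₁ E₀ G₀ G₁ e₁ e₀ g₀ g₁} → E₁ ≈ e₁ → G₀ ≈ g₀ → E₀ ≈ e₀ → G₁ ≈ g₁ →
        (E₁ * σ′) * G₀ + (E₀ * σ) * G₁ ≈ (e₁ * σ′) * g₀ + (e₀ * σ) * g₁
      entries E₁≈ G₀≈ E₀≈ G₁≈ = +-cong (*-cong (*-congʳ E₁≈) G₀≈) (*-cong (*-congʳ E₀≈) G₁≈)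

    outside-block-column : ∀ p {q} → q ≤ r → q ≢ i → q ≢ suc i → mul (suc r) EP G p q ≈ Pℕ r p q
    outside-block-column p {q} q≤r q≢i q≢1+i = begin
      mul (suc r) EP G p q   ≈⟨ mul-unit-column (suc r) EP G p (s≤s q≤r) (λ k → G.cols-outside k q q≢i q≢1+i) ⟩
      EP p q                 ≈⟨ mul-P r E p m+q≡r ⟩
      E p m * ε r m          ≈⟨ *-congʳ (E.cols-outside p m m≢K m≢1+K) ⟩
      δ p m * ε r m          ≈⟨ P-as-δ r p m+q≡r ⟨
      Pℕ r p q               ∎
      where
      -- column q of P has its entry in row m, which lies outside E's block
      m : ℕ
      m = r ∸ q
      m+q≡r : m ℕ.+ q ≡ r
      m+q≡r = ℕP.m∸n+n≡m q≤r
      m≢K : m ≢ K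
      m≢K m≡K = q≢1+i (complement-uniqueʳ (≡.subst (λ n → n ℕ.+ q ≡ r) m≡K m+q≡r) K+1+i≡r)
      m≢1+K : m ≢ suc K
      m≢1+K m≡1+K = q≢i (complement-uniqueʳ (≡.subst (λ n → n ℕ.+ q ≡ r) m≡1+K m+q≡r) 1+K+i≡r)

    block-column : ∀ p {q} → (∀ k → k ≢ i → k ≢ suc i → k ≢ q) →
      mul (suc r) EP G p q ≈ (E p (suc K) * σ′) * G i q + (E p K * σ) * G (suc i) q
    block-column p q-in-block = trans
      (mul-block-column (suc r) EP G G-block 1+i<1+r p q-in-block)
      (+-cong (*-congʳ (mul-P r E p 1+K+i≡r)) (*-congʳ (mul-P r E p K+1+i≡r)))

    outside-row : ∀ {row} → row ≢ K → row ≢ suc K → ∀ u v →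
      (E row (suc K) * σ′) * u + (E row K * σ) * v ≈ 0#
    outside-row {row} row≢K row≢1+K u v = begin
      (E row (suc K) * σ′) * u + (E row K * σ) * v  ≈⟨ entries (vanishes (suc K) row≢1+K) refl (vanishes K row≢K) refl ⟩
      (0# * σ′) * u + (0# * σ) * v                  ≈⟨ +-cong (zero-coefficient σ′ u) (zero-coefficient σ v) ⟩
      0# + 0#                                       ≈⟨ +-identityʳ 0# ⟩
      0#                                            ∎
      where
      vanishes : ∀ col → row ≢ col → E row col ≈ 0#
      vanishes col row≢col = trans (E.rows-outside row col row≢K row≢1+K) (δ-≢ row≢col)

    sandwich :
      (y * σ′) * x′ + (x * σ) * z′ ≈ 0# → (y * σ′) * y′ + (x * σ) * w′ ≈ σ →
      (w * σ′) * x′ + (z * σ) * z′ ≈ σ′ → (w * σ′) * y′ + (z * σ) * w′ ≈ 0# →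
      ∀ p q → q ≤ r → mul (suc r) (mul (suc r) E (Pℕ r)) G p q ≈ Pℕ r p q
    sandwich c₀₀ c₀₁ c₁₀ c₁₁ p q q≤r = by-column (slot i q) q≤r
      where
      first-column : ∀ {row} → Slot K row →
        (E row (suc K) * σ′) * G i i + (E row K * σ) * G (suc i) i ≈ Pℕ r row i
      first-column first  = trans (entries E.entry₀₁ G.entry₀₀ E.entry₀₀ G.entry₁₀)
        (trans c₀₀ (sym (P-off r K i (λ K+i≡r → ℕP.<⇒≢ (ℕP.n<1+n i) (complement-uniqueʳ K+i≡r K+1+i≡r)))))
      first-column second = trans (entries E.entry₁₁ G.entry₀₀ E.entry₁₀ G.entry₁₀)
        (trans c₁₀ (sym (P-on r (suc K) i 1+K+i≡r)))
      first-column {row} (outside row≢K row≢1+K) = trans (outside-row row≢K row≢1+K _ _)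
        (sym (P-off r row i (λ row+i≡r → row≢1+K (complement-uniqueˡ row+i≡r 1+K+i≡r))))

      second-column : ∀ {row} → Slot K row →
        (E row (suc K) * σ′) * G i (suc i) + (E row K * σ) * G (suc i) (suc i) ≈ Pℕ r row (suc i)
      second-column first  = trans (entries E.entry₀₁ G.entry₀₁ E.entry₀₀ G.entry₁₁)
        (trans c₀₁ (sym (P-on r K (suc i) K+1+i≡r)))
      second-column second = trans (entries E.entry₁₁ G.entry₀₁ E.entry₁₀ G.entry₁₁)
        (trans c₁₁ (sym (P-off r (suc K) (suc i)
          (λ 1+K+1+i≡r → ℕP.1+n≢n (complement-uniqueʳ {suc K} 1+K+1+i≡r 1+K+i≡r)))))
      second-column {row} (outside row≢K row≢1+K) = trans (outside-row row≢K row≢1+K _ _)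
        (sym (P-off r row (suc i) (λ row+1+i≡r → row≢K (complement-uniqueˡ row+1+i≡r K+1+i≡r))))

      by-column : ∀ {q} → Slot i q → q ≤ r → mul (suc r) EP G p q ≈ Pℕ r p q
      by-column first  _ = trans (block-column p (λ k k≢i _ → k≢i)) (first-column (slot K p))
      by-column second _ = trans (block-column p (λ k _ k≢1+i → k≢1+i)) (second-column (slot K p))
      by-column (outside q≢i q≢1+i) q≤r = outside-block-column p q≤r q≢i q≢1+i

  opposite-signs : ∀ τ x u → x * (τ * u) + ((- τ) * x) * u ≈ 0#
  opposite-signs τ x u = begin
    x * (τ * u) + ((- τ) * x) * u      ≈⟨ +-cong (solve 3 (λ τ x u → x ⊕ (τ ⊕ u) ⊜ τ ⊕ (x ⊕ u)) refl τ x u)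
                                                 (trans (*-assoc (- τ) x u) (sym (-‿distribˡ-* τ (x * u)))) ⟩
    τ * (x * u) + - (τ * (x * u))      ≈⟨ -‿inverseʳ _ ⟩
    0#                                 ∎

  sign-cancel : ∀ {τ} x u → τ * τ ≈ 1# → ((- τ) * x) * (τ * u) + x * u ≈ 0#
  sign-cancel {τ} x u ττ≈1 = begin
    ((- τ) * x) * (τ * u) + x * u        ≈⟨ +-congʳ (solve 4 (λ ν τ x u → (ν ⊕ x) ⊕ (τ ⊕ u) ⊜ ν ⊕ (τ ⊕ (x ⊕ u)))
                                                          refl (- τ) τ x u) ⟩
    (- τ) * (τ * (x * u)) + x * u        ≈⟨ +-congʳ (sym (-‿distribˡ-* τ _)) ⟩
    - (τ * (τ * (x * u))) + x * u        ≈⟨ +-congʳ (-‿cong (unit-cancelˡ ττ≈1)) ⟩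
    - (x * u) + x * u                    ≈⟨ -‿inverseˡ _ ⟩
    0#                                   ∎

  V-P-U : ∀ {r K i I A B C a b c′ τ} → I ≡ suc K → K ℕ.+ suc i ≡ r →
    ¬ (a ≈ 0#) → ¬ (b ≈ 0#) → τ * τ ≈ 1# → ε r (suc K) ≈ τ * ε r K →
    A / C ≈ (- τ) * (c′ / a) → B / C ≈ b / a →
    ∀ p q → q ≤ r → mul (suc r) (mul (suc r) (Vℕ r I A B C) (Pℕ r)) (Uℕ r (suc i) a b c′) p q ≈ Pℕ r p q
  V-P-U {r} {K} {i} {A = A} {B} {C} {a} {b} {c′} {τ} ≡.refl K+1+i≡r a≉0 b≉0 ττ≈1 σ′≈τσ A/C≈ B/C≈ =
    sandwich K+1+i≡r (V-is-block r K A B C) (U-is-block r i a b c′) top-left top-right bottom-left bottom-right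
    where
    σ σ′ : Carrier
    σ  = ε r K
    σ′ = ε r (suc K)

    top-left : ((A / C) * σ′) * 1# + ((B / C) * σ) * (c′ / b) ≈ 0#
    top-left = begin
      ((A / C) * σ′) * 1# + ((B / C) * σ) * (c′ / b)             ≈⟨ +-cong (trans (*-identityʳ _) (*-cong A/C≈ σ′≈τσ))
                                                                           (*-congʳ (*-congʳ B/C≈)) ⟩
      ((- τ) * (c′ / a)) * (τ * σ) + ((b / a) * σ) * (c′ / b)   ≈⟨ +-congˡ (quotient-chain σ b≉0) ⟩
      ((- τ) * (c′ / a)) * (τ * σ) + (c′ / a) * σ               ≈⟨ sign-cancel (c′ / a) σ ττ≈1 ⟩
      0#                                                        ∎

    top-right : ((A / C) * σ′) * 0# + ((B / C) * σ) * (a / b) ≈ σ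
    top-right = trans (+-cong (zeroʳ _) (trans (*-congʳ (*-congʳ B/C≈)) (quotient-cancel σ b≉0 a≉0))) (+-identityˡ σ)

    bottom-left : (1# * σ′) * 1# + (0# * σ) * (c′ / b) ≈ σ′
    bottom-left = trans (+-cong (unit-coefficient σ′) (zero-coefficient σ _)) (+-identityʳ σ′)

    bottom-right : (1# * σ′) * 0# + (0# * σ) * (a / b) ≈ 0#
    bottom-right = trans (+-cong (zeroʳ _) (zero-coefficient σ _)) (+-identityʳ 0#)

  U-P-V : ∀ {r K i I A B C a b c′ τ} → I ≡ suc K → K ℕ.+ suc i ≡ r →
    ¬ (b ≈ 0#) → ¬ (c′ ≈ 0#) → ε r (suc K) ≈ τ * ε r K →
    A / B ≈ c′ / b → C / B ≈ (- τ) * (a / b) →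
    ∀ p q → q ≤ r → mul (suc r) (mul (suc r) (Uℕ r I A B C) (Pℕ r)) (Vℕ r (suc i) a b c′) p q ≈ Pℕ r p q
  U-P-V {r} {K} {i} {A = A} {B} {C} {a} {b} {c′} {τ} ≡.refl K+1+i≡r b≉0 c≉0 σ′≈τσ A/B≈ C/B≈ =
    sandwich K+1+i≡r (U-is-block r K A B C) (V-is-block r i a b c′) top-left top-right bottom-left bottom-right
    where
    σ σ′ : Carrier
    σ  = ε r K
    σ′ = ε r (suc K)

    top-left : (0# * σ′) * (b / c′) + (1# * σ) * 0# ≈ 0#
    top-left = trans (+-cong (zero-coefficient σ′ _) (zeroʳ _)) (+-identityʳ 0#)

    top-right : (0# * σ′) * (a / c′) + (1# * σ) * 1# ≈ σ
    top-right = trans (+-cong (zero-coefficient σ′ _) (unit-coefficient σ)) (+-identityˡ σ)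

    bottom-left : ((A / B) * σ′) * (b / c′) + ((C / B) * σ) * 0# ≈ σ′
    bottom-left = trans (+-cong (trans (*-congʳ (*-congʳ A/B≈)) (quotient-cancel σ′ c≉0 b≉0)) (zeroʳ _))
                        (+-identityʳ σ′)

    bottom-right : ((A / B) * σ′) * (a / c′) + ((C / B) * σ) * 1# ≈ 0#
    bottom-right = begin
      ((A / B) * σ′) * (a / c′) + ((C / B) * σ) * 1#            ≈⟨ +-cong (*-congʳ (*-cong A/B≈ σ′≈τσ))
                                                                           (trans (*-identityʳ _) (*-congʳ C/B≈)) ⟩
      ((c′ / b) * (τ * σ)) * (a / c′) + ((- τ) * (a / b)) * σ   ≈⟨ +-congʳ (quotient-chain (τ * σ) c≉0) ⟩
      (a / b) * (τ * σ) + ((- τ) * (a / b)) * σ                 ≈⟨ opposite-signs τ (a / b) σ ⟩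
      0#                                                        ∎

  transfer : ∀ r (E′ G′ : MatN) {E G : Mat (suc r)} → E′ represents E → G′ represents G →
    (∀ p q → q ≤ r → mul (suc r) (mul (suc r) E′ (Pℕ r)) G′ p q ≈ Pℕ r p q) →
    ((E · P r) · G) ≈M P r
  transfer r E′ G′ {E} {G} E≈ G≈ E′PG′≈P p q = begin
    ((E · P r) · G) p q                                        ≈⟨ mul-represents (suc r) (mul (suc r) E′ (Pℕ r)) G′
                                                                    (mul-represents (suc r) E′ (Pℕ r) E≈ (P-represented r)) G≈ p q ⟩
    mul (suc r) (mul (suc r) E′ (Pℕ r)) G′ (toℕ p) (toℕ q)     ≈⟨ E′PG′≈P (toℕ p) (toℕ q) (ℕP.≤-pred (toℕ<n q)) ⟩
    Pℕ r (toℕ p) (toℕ q)                                       ≈⟨ P-represented r p q ⟨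
    P r p q                                                    ∎

  module Family (r′ : ℕ) (t : ℕ → ℤ → Carrier)
    (t₀     : ∀ j → t 0 j ≈ 1#)
    (t₁     : ∀ j → t (suc (suc r′)) j ≈ 1#)
    (t-init : ∀ i → 1 ≤ i → i ≤ suc r′ → t i (+ 0) ≈ 1#)
    (t≉0    : ∀ i j → 1 ≤ i → i ≤ suc r′ → 1 ≤ j → ¬ (t i (+ j) ≈ 0#))
    (t-sym  : ∀ i j → 1 ≤ i → i ≤ suc r′ →
              t (suc (suc r′) ∸ i) (-ℤ (+ (suc (suc r′) ℕ.+ j))) ≈ sgn (suc r′ ℕ.* i) * t i (+ j))
    where

    r : ℕ
    r = suc r′

    t-nonzero : ∀ i j → 1 ≤ i → i ≤ r → ¬ (t i (+ j) ≈ 0#)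
    t-nonzero i zero    1≤i i≤r t≈0 = 1≉0 (trans (sym (t-init i 1≤i i≤r)) t≈0)
    t-nonzero i (suc j) 1≤i i≤r     = t≉0 i (suc j) 1≤i i≤r (s≤s z≤n)

    t-mirror : ∀ i j → i ≤ suc r → t (suc r ∸ i) (-ℤ (+ (suc r ℕ.+ j))) ≈ sgn (r ℕ.* i) * t i (+ j)
    t-mirror zero j _ = begin
      t (suc r) (-ℤ (+ (suc r ℕ.+ j)))   ≈⟨ trans (t₁ _) (sym (t₀ _)) ⟩
      t 0 (+ j)                          ≈⟨ *-identityˡ _ ⟨
      1# * t 0 (+ j)                     ≈⟨ *-congʳ (reflexive (≡.cong sgn (ℕP.*-zeroʳ r))) ⟨
      sgn (r ℕ.* 0) * t 0 (+ j)          ∎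
    t-mirror (suc i) j 1+i≤1+r with ℕP.m≤n⇒m<n∨m≡n 1+i≤1+r
    ... | inj₁ 1+i<1+r = t-sym (suc i) j (s≤s z≤n) (ℕP.≤-pred 1+i<1+r)
    ... | inj₂ ≡.refl  = begin
      t (r ∸ r) (-ℤ (+ (suc r ℕ.+ j)))        ≈⟨ reflexive (≡.cong (λ n → t n (-ℤ (+ (suc r ℕ.+ j)))) (ℕP.n∸n≡0 r)) ⟩
      t 0 (-ℤ (+ (suc r ℕ.+ j)))              ≈⟨ t₀ _ ⟩
      1#                                      ≈⟨ sgn-square r ⟨
      sgn r * sgn r                           ≈⟨ *-congˡ (sgn-of-square r) ⟨
      sgn r * sgn (r ℕ.* r)                   ≈⟨ sgn-*suc r r ⟨
      sgn (r ℕ.* suc r)                       ≈⟨ *-identityʳ _ ⟨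
      sgn (r ℕ.* suc r) * 1#                  ≈⟨ *-congˡ (t₁ (+ j)) ⟨
      sgn (r ℕ.* suc r) * t (suc r) (+ j)     ∎

    -- The statement writes -(r + (j′+1)) for -(r + 1 + j′).
    reindex : ∀ x j → t x (-ℤ (+ (r ℕ.+ suc j))) ≈ t x (-ℤ (+ (suc r ℕ.+ j)))
    reindex x j = reflexive (≡.cong (λ n → t x (-ℤ (+ n))) (ℕP.+-suc r j))

    module _ (i′ j′ : ℕ) (i≤r : suc i′ ≤ r) where

      private
        a b c₊ c₋ : Carrier
        a  = t (suc i′) (+ j′)
        b  = t (suc i′) (+ suc j′)
        c₊ = t (suc (suc i′)) (+ j′)
        c₋ = t i′ (+ suc j′)

        a* b* c₊* c₋* : Carrier
        a*  = t (r ∸ i′) (-ℤ (+ (r ℕ.+ suc j′)))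
        b*  = t (r ∸ i′) (-ℤ (+ (suc r ℕ.+ suc j′)))
        c₊* = t (r ∸ suc i′) (-ℤ (+ (r ℕ.+ suc j′)))
        c₋* = t (suc r ∸ i′) (-ℤ (+ (suc r ℕ.+ suc j′)))

        -- the left factors sit at K, K+1 where K + i = r
        K : ℕ
        K = r ∸ suc i′

        K+1+i′≡r : K ℕ.+ suc i′ ≡ r
        K+1+i′≡r = ℕP.m∸n+n≡m i≤r

        r∸i′≡1+K : r ∸ i′ ≡ suc K
        r∸i′≡1+K = ℕP.+-∸-assoc 1 i≤r

        ε-step : ε r (suc K) ≈ sgn r′ * ε r K
        ε-step = sgn-*suc r′ K

        s : Carrier
        s = sgn (r ℕ.* suc i′)

        s² : s * s ≈ 1#
        s² = sgn-square (r ℕ.* suc i′)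

        a≉0 : ¬ (a ≈ 0#)
        a≉0 = t-nonzero (suc i′) j′ (s≤s z≤n) i≤r

        b≉0 : ¬ (b ≈ 0#)
        b≉0 = t-nonzero (suc i′) (suc j′) (s≤s z≤n) i≤r

        a*≈ : a* ≈ s * a
        a*≈ = trans (reindex _ j′) (t-mirror (suc i′) j′ (ℕP.m≤n⇒m≤1+n i≤r))

        b*≈ : b* ≈ s * b
        b*≈ = t-mirror (suc i′) (suc j′) (ℕP.m≤n⇒m≤1+n i≤r)

        c₊*≈ : c₊* ≈ (sgn r * s) * c₊
        c₊*≈ = trans (reindex _ j′) (trans (t-mirror (suc (suc i′)) j′ (s≤s i≤r)) (*-congʳ (sgn-*suc r (suc i′))))

        c₋*≈ : c₋* ≈ (sgn r * s) * c₋
        c₋*≈ = trans (t-mirror i′ (suc j′) (ℕP.m≤n⇒m≤1+n (ℕP.<⇒≤ i≤r)))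
          (*-congʳ (sym (trans (*-congˡ (sgn-*suc r i′)) (unit-cancelˡ (sgn-square r)))))

      first-identity : ((V r (r ∸ i′) c₊* b* a* · P r) · U r (suc i′) a b c₊) ≈M P r
      first-identity = transfer r (Vℕ r (r ∸ i′) c₊* b* a*) (Uℕ r (suc i′) a b c₊)
        (V-represented r (r ∸ i′) c₊* b* a*) (U-represented r (suc i′) a b c₊)
        (V-P-U r∸i′≡1+K K+1+i′≡r a≉0 b≉0 (sgn-square r′) ε-step
          (signed-quotient s² a≉0 c₊*≈ a*≈) (same-sign-quotient s² a≉0 b*≈ a*≈))

      second-identity : ((U r (r ∸ i′) b* a* c₋* · P r) · V r (suc i′) c₋ a b) ≈M P r
      second-identity = transfer r (Uℕ r (r ∸ i′) b* a* c₋*) (Vℕ r (suc i′) c₋ a b)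
        (U-represented r (r ∸ i′) b* a* c₋*) (V-represented r (suc i′) c₋ a b)
        (U-P-V r∸i′≡1+K K+1+i′≡r a≉0 b≉0 ε-step
          (same-sign-quotient s² a≉0 b*≈ a*≈) (signed-quotient s² a≉0 c₋*≈ a*≈))

lemma5p21 : ∀ {c ℓ} (F : Field c ℓ) → let open Matrices F in
    (r : ℕ) → 1 ≤ r → (t : ℕ → ℤ → Carrier) →
    (∀ j → t 0 j ≈ 1#) →
    (∀ j → t (suc r) j ≈ 1#) →
    (∀ i → 1 ≤ i → i ≤ r → t i (+ 0) ≈ 1#) →
    (∀ i j → 1 ≤ i → i ≤ r → 1 ≤ j → ¬ (t i (+ j) ≈ 0#)) →
    (∀ i j → 1 ≤ i → i ≤ r →
      t (suc r ∸ i) (-ℤ (+ (suc r ℕ.+ j))) ≈ sgn (r ℕ.* i) * t i (+ j)) →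
    ∀ i j → 1 ≤ i → i ≤ r → 1 ≤ j →
      ((V r (suc r ∸ i) (t (r ∸ i) (-ℤ (+ (r ℕ.+ j)))) (t (suc r ∸ i) (-ℤ (+ (suc r ℕ.+ j)))) (t (suc r ∸ i) (-ℤ (+ (r ℕ.+ j))))
          · P r) · U r i (t i (+ (j ∸ 1))) (t i (+ j)) (t (suc i) (+ (j ∸ 1))))
        ≈M P r
      ×
      ((U r (suc r ∸ i) (t (suc r ∸ i) (-ℤ (+ (suc r ℕ.+ j)))) (t (suc r ∸ i) (-ℤ (+ (r ℕ.+ j)))) (t (suc (suc r) ∸ i) (-ℤ (+ (suc r ℕ.+ j))))
          · P r) · V r i (t (i ∸ 1) (+ j)) (t i (+ (j ∸ 1))) (t i (+ j)))
        ≈M P r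
lemma5p21 F (suc r′) _ t t₀ t₁ t-init t≉0 t-sym (suc i′) (suc j′) _ i≤r _ =
  first-identity i′ j′ i≤r , second-identity i′ j′ i≤r
  where
  open Development F
  open Family r′ t t₀ t₁ t-init t≉0 t-sym
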